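{- Let $S$ be a read-$k$, per-read-monotone sequence over $X=\{x_1,\dots,x_n\}$ (ordered $x_1<\dots<x_n$), and suppose $S^{(1)}$ is monotonically increasing. Then $S$ can be written as a concatenation $S=(T_1,T_2,\dots,T_t)$ of contiguous subsequences such that: (1) for every $j\in[t]$, $T_j$ is a read-$k_j$ sequence over $X$ for some $k_j\le k$; (2) for every $i\in[k]$ there exists $j\in[t]$ such that $S^{(i)}$ is contained in $T_j$; (3) for every odd $j$, all the subsequences $S^{(i)}$ contained in $T_j$ are monotonically increasing, and for every even $j$ they are all monotonically decreasing; (4) for every $j\in[t-1]$, the last element of $T_j$ equals the first element of $T_{j+1}$, and this element is $x_n$ if $T_j$ contains increasing subsequences and $T_{j+1}$ decreasing ones, and $x_1$ in the opposite case.
   Context: A sequence $S$ of elements of a finite set $X$ is read-$k$ if every element of $X$ occurs exactly $k$ times in $S$. For $i\in[k]$, $S^{(i)}$ denotes the subsequence of $S$ consisting of the $i$-th occurrences of the elements. A read-$k$ sequence is per-read-monotone if for every $i\in[k]$, $S^{(i)}$ is monotone (increasing or decreasing) with respect to the order $x_1<\dots<x_n$. -}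

module Defs where

open import Data.Nat using (ℕ; zero; suc; _+_; _≤_; _<_; _%_)
import Data.Nat as ℕ
open import Data.Fin using (Fin; toℕ)
import Data.Fin as F
open import Data.List using (List; []; _∷_; length; filter; take; map; lookup; allFin)
open import Data.Nat.ListAction using (sum)
open import Data.List.Relation.Unary.Linked using (Linked)
open import Data.Product using (∃; _×_)
open import Data.Sum using (_⊎_)
open import Relation.Binary.PropositionalEquality using (_≡_)

-- The ground set X = {x_1 < ... < x_n} is modelled by Fin n with its usual order
-- (x_1 = index 0, x_n = index n-1).

count : ∀ {n} → Fin n → List (Fin n) → ℕ
count x xs = length (filter (x F.≟_) xs)

ReadK : ∀ {n} → ℕ → List (Fin n) → Set
ReadK k S = ∀ x → count x S ≡ k

occ : ∀ {n} (S : List (Fin n)) → Fin (length S) → ℕ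
occ S p = count (lookup S p) (take (toℕ p) S)

-- S^(i+1) in the paper's notation (reads are 0-based here):
-- subsequence of S consisting of the positions whose occurrence index is i
reading : ∀ {n} → List (Fin n) → ℕ → List (Fin n)
reading S i = map (lookup S) (filter (λ p → occ S p ℕ.≟ i) (allFin (length S)))

Increasing : ∀ {n} → List (Fin n) → Set
Increasing = Linked F._<_

Decreasing : ∀ {n} → List (Fin n) → Set
Decreasing = Linked F._>_

PerReadMonotone : ∀ {n} → ℕ → List (Fin n) → Set
PerReadMonotone k S = ∀ i → i < k → Increasing (reading S i) ⊎ Decreasing (reading S i)

-- j-th block (0-based) of a decomposition (only used for j < length Ts)
blk : ∀ {n} → List (List (Fin n)) → ℕ → List (Fin n)
blk []       _       = []
blk (T ∷ Ts) zero    = T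
blk (T ∷ Ts) (suc j) = blk Ts j

offset : ∀ {n} → List (List (Fin n)) → ℕ → ℕ
offset Ts j = sum (map length (take j Ts))

-- S^(i) (0-based i) is contained in block j: every position of S carrying an
-- i-th occurrence lies inside the contiguous segment of S occupied by block j
Contained : ∀ {n} (S : List (Fin n)) (Ts : List (List (Fin n))) → ℕ → ℕ → Set
Contained S Ts i j =
  ∀ (p : Fin (length S)) → occ S p ≡ i →
    offset Ts j ≤ toℕ p × toℕ p < offset Ts j + length (blk Ts j)

ContainsInc : ∀ {n} → ℕ → List (Fin n) → List (List (Fin n)) → ℕ → Set
ContainsInc k S Ts j = ∃ λ i → i < k × Contained S Ts i j × Increasing (reading S i)

ContainsDec : ∀ {n} → ℕ → List (Fin n) → List (List (Fin n)) → ℕ → Set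
ContainsDec k S Ts j = ∃ λ i → i < k × Contained S Ts i j × Decreasing (reading S i)

module Submission where

-- Write C x e for the number of copies of the letter x among the first e entries of S and
-- call the prefix of length e balanced of level c when C x e = c for every x.  A balanced
-- prefix of level c holds exactly the reads 0, …, c−1 (occurrence indices are 0-based), so
-- cutting S at balanced prefixes of levels a < c yields a read-(c−a) block holding exactly
-- the reads a, …, c−1.  Balanced prefixes arise at every change of direction: if read c is
-- increasing and read c+1 decreasing, then read c ends and read c+1 starts with x_n, at
-- adjacent positions p and p+1, and the prefix of length p+1 is balanced of level c+1
-- (symmetrically with x_1).

open import Defs

open import Data.Bool using (Bool; true; false; not)
import Data.Bool as Bool
open import Data.Bool.Properties using (¬-not; not-injective)
open import Data.Empty using (⊥-elim)
open import Data.Fin using (Fin; toℕ; fromℕ; fromℕ<)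
import Data.Fin as F
import Data.Fin.Properties as FP
open import Data.List using (List; []; _∷_; [_]; length; concat; head; last; take; drop; _++_; _∷ʳ_; filter; lookup; allFin)
open import Data.List.Properties
  using (length-take; length-drop; length-++; filter-++; take-suc; take-all; take-[]; drop-drop; drop-all; take++drop≡id; ++-identityʳ)
open import Data.List.Membership.Propositional using (_∈_)
open import Data.List.Membership.Propositional.Properties using (∈-filter⁺; ∈-allFin)
open import Data.List.Relation.Unary.Any using (here; there)
import Data.List.Relation.Unary.All as All
open import Data.List.Relation.Unary.AllPairs as AllPairs using (AllPairs; _∷_)
import Data.List.Relation.Unary.AllPairs.Properties as AllPairsₚ
open import Data.List.Relation.Unary.Linked using (Linked; []; linked?)
open import Data.List.Relation.Unary.Linked.Properties using (Linked⇒AllPairs)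
open import Data.Maybe using (just)
open import Data.Nat using (ℕ; zero; suc; _+_; _∸_; _≤_; _<_; _%_; z≤n; s≤s; _<?_)
import Data.Nat as ℕ
open import Data.Nat.Properties
open import Data.Product using (Σ; ∃; _×_; _,_; proj₁; proj₂)
open import Data.Sum using (_⊎_; inj₁; inj₂)
open import Function using (id)
open import Level using (0ℓ)
open import Relation.Binary.Core using (Rel)
open import Relation.Binary.Definitions using (Transitive)
open import Relation.Nullary using (¬_; Dec; yes; no; does; contradiction)
open import Relation.Nullary.Decidable using (dec-true)
open import Relation.Binary.PropositionalEquality hiding ([_])

module _ {A : Set} where

  segment : ℕ → ℕ → List A → List A
  segment e e' xs = take (e' ∸ e) (drop e xs)

  take-segment : ∀ {e e'} (xs : List A) → e ≤ e' → take e' xs ≡ take e xs ++ segment e e' xs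
  take-segment {e} {e'} xs e≤e' = begin
      take e' xs                    ≡⟨ cong (λ m → take m xs) (sym (m+[n∸m]≡n e≤e')) ⟩
      take (e + (e' ∸ e)) xs        ≡⟨ take-+ e (e' ∸ e) xs ⟩
      take e xs ++ segment e e' xs  ∎
    where
    open ≡-Reasoning
    take-+ : ∀ e d (xs : List A) → take (e + d) xs ≡ take e xs ++ take d (drop e xs)
    take-+ zero    d xs       = refl
    take-+ (suc e) d []       = sym (take-[] d)
    take-+ (suc e) d (x ∷ xs) = cong (x ∷_) (take-+ e d xs)

  segment-++ : ∀ {e e'} (xs : List A) → e ≤ e' → segment e e' xs ++ drop e' xs ≡ drop e xs
  segment-++ {e} {e'} xs e≤e' = begin
      segment e e' xs ++ drop e' xs                  ≡⟨ cong (segment e e' xs ++_) drop-later ⟩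
      segment e e' xs ++ drop (e' ∸ e) (drop e xs)   ≡⟨ take++drop≡id (e' ∸ e) (drop e xs) ⟩
      drop e xs                                      ∎
    where
    open ≡-Reasoning
    drop-later : drop e' xs ≡ drop (e' ∸ e) (drop e xs)
    drop-later = trans (cong (λ m → drop m xs) (sym (m+[n∸m]≡n e≤e'))) (sym (drop-drop e (e' ∸ e) xs))

  segment-length : ∀ {e e'} (xs : List A) → e ≤ e' → e' ≤ length xs → e + length (segment e e' xs) ≡ e'
  segment-length {e} {e'} xs e≤e' e'≤len = begin
      e + length (segment e e' xs)           ≡⟨ cong (e +_) (length-take (e' ∸ e) (drop e xs)) ⟩
      e + ((e' ∸ e) ℕ.⊓ length (drop e xs))  ≡⟨ cong (e +_) (m≤n⇒m⊓n≡m fits) ⟩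
      e + (e' ∸ e)                           ≡⟨ m+[n∸m]≡n e≤e' ⟩
      e'                                     ∎
    where
    open ≡-Reasoning
    fits : e' ∸ e ≤ length (drop e xs)
    fits = subst (e' ∸ e ≤_) (sym (length-drop e xs)) (∸-monoˡ-≤ e e'≤len)

  segment-head : ∀ {e e'} (xs : List A) → e < e' → head (segment e e' xs) ≡ head (drop e xs)
  segment-head {e} {suc q} xs (s≤s e≤q) =
    trans (cong (λ m → head (take m (drop e xs))) (+-∸-assoc 1 e≤q)) (head-take (drop e xs))
    where
    head-take : ∀ {m} (ys : List A) → head (take (suc m) ys) ≡ head ys
    head-take []      = refl
    head-take (_ ∷ _) = refl

  segment-last : ∀ {e} (xs : List A) (p : Fin (length xs)) → e ≤ toℕ p →
                 last (segment e (suc (toℕ p)) xs) ≡ just (lookup xs p)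
  segment-last {zero}  xs       p         _         =
    trans (cong last (take-suc xs p)) (last-∷ʳ (take (toℕ p) xs))
    where
    last-∷ʳ : ∀ {y} (ys : List A) → last (ys ∷ʳ y) ≡ just y
    last-∷ʳ []           = refl
    last-∷ʳ (_ ∷ [])     = refl
    last-∷ʳ (_ ∷ z ∷ zs) = last-∷ʳ (z ∷ zs)
  segment-last {suc e} (x ∷ xs) (F.suc p) (s≤s e≤p) = segment-last xs p e≤p

  head-drop : ∀ (xs : List A) (r : Fin (length xs)) → head (drop (toℕ r) xs) ≡ just (lookup xs r)
  head-drop (x ∷ xs) F.zero    = refl
  head-drop (x ∷ xs) (F.suc r) = head-drop xs r

  allPairs-trichotomy : ∀ {R : Rel A 0ℓ} {xs a b} → AllPairs R xs → a ∈ xs → b ∈ xs → a ≡ b ⊎ R a b ⊎ R b a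
  allPairs-trichotomy (_   ∷ _)  (here refl) (here refl) = inj₁ refl
  allPairs-trichotomy (R-x ∷ _)  (here refl) (there b∈)  = inj₂ (inj₁ (All.lookup R-x b∈))
  allPairs-trichotomy (R-x ∷ _)  (there a∈)  (here refl) = inj₂ (inj₂ (All.lookup R-x a∈))
  allPairs-trichotomy (_   ∷ Rs) (there a∈)  (there b∈)  = allPairs-trichotomy Rs a∈ b∈

module _ {n : ℕ} where

  count-++ : ∀ (x : Fin n) xs ys → count x (xs ++ ys) ≡ count x xs + count x ys
  count-++ x xs ys = trans (cong length (filter-++ (x F.≟_) xs ys)) (length-++ (filter (x F.≟_) xs))

  count-self : ∀ (x : Fin n) → count x [ x ] ≡ 1
  count-self x with x F.≟ x
  ... | yes _  = refl
  ... | no x≢x = contradiction refl x≢x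

  count-other : ∀ {x y : Fin n} → x ≢ y → count x [ y ] ≡ 0
  count-other {x} {y} x≢y with x F.≟ y
  ... | yes x≡y = contradiction x≡y x≢y
  ... | no _    = refl

-- Prefix counts and balanced prefixes of an arbitrary sequence S.

module PrefixCounts {n : ℕ} (S : List (Fin n)) where

  Pos : Set
  Pos = Fin (length S)

  el : Pos → Fin n
  el = lookup S

  -- Copies of x among the first e entries; note occ S p = C (el p) (toℕ p) by definition.
  C : Fin n → ℕ → ℕ
  C x e = count x (take e S)

  C-segment : ∀ x {e e'} → e ≤ e' → C x e' ≡ C x e + count x (segment e e' S)
  C-segment x {e} e≤e' = trans (cong (count x) (take-segment S e≤e')) (count-++ x (take e S) _)

  C-mono : ∀ x {e e'} → e ≤ e' → C x e ≤ C x e'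
  C-mono x {e} e≤e' = subst (C x e ≤_) (sym (C-segment x e≤e')) (m≤m+n (C x e) _)

  C-step : ∀ x p → C x (suc (toℕ p)) ≡ C x (toℕ p) + count x [ el p ]
  C-step x p = trans (cong (count x) (take-suc S p)) (count-++ x (take (toℕ p) S) [ el p ])

  C-after-self : ∀ p → C (el p) (suc (toℕ p)) ≡ suc (occ S p)
  C-after-self p = trans (C-step (el p) p) (trans (cong (occ S p +_) (count-self (el p))) (+-comm (occ S p) 1))

  -- If the prefix of length e holds more than r copies of x, the r-th copy lies in it:
  -- either already in the prefix of length e−1, or it is the entry at position e−1.
  occurrence : ∀ x r e → e ≤ length S → r < C x e → Σ Pos λ p → toℕ p < e × el p ≡ x × occ S p ≡ r
  occurrence x r zero    _   ()
  occurrence x r (suc e) e<N r<C with r <? C x e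
  ... | yes r<Ce = let p , p<e , el-p , occ-p = occurrence x r e (<⇒≤ e<N) r<Ce
                   in p , m<n⇒m<1+n p<e , el-p , occ-p
  ... | no r≮Ce = at-p (x F.≟ el p)
    where
    p : Pos
    p = fromℕ< e<N
    p≡e : toℕ p ≡ e
    p≡e = FP.toℕ-fromℕ< e<N
    step : C x (suc e) ≡ C x e + count x [ el p ]
    step = subst (λ m → C x (suc m) ≡ C x m + count x [ el p ]) p≡e (C-step x p)
    at-p : Dec (x ≡ el p) → Σ Pos λ p → toℕ p < suc e × el p ≡ x × occ S p ≡ r
    at-p (yes x≡el-p) = p , ≤-reflexive (cong suc p≡e) , sym x≡el-p , occ-p
      where
      one-more : C x (suc e) ≡ suc (C x e)
      one-more = trans step (trans (cong (C x e +_) (subst (λ y → count x [ y ] ≡ 1) x≡el-p (count-self x)))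
                                   (+-comm (C x e) 1))
      occ-p : occ S p ≡ r
      occ-p = trans (cong₂ C (sym x≡el-p) p≡e) (≤-antisym (≮⇒≥ r≮Ce) (≤-pred (subst (r <_) one-more r<C)))
    at-p (no x≢el-p) = contradiction (subst (r <_) no-more r<C) r≮Ce
      where
      no-more : C x (suc e) ≡ C x e
      no-more = trans step (trans (cong (C x e +_) (count-other x≢el-p)) (+-identityʳ (C x e)))

  occ-order : ∀ p q → el p ≡ el q → occ S p < occ S q → toℕ p < toℕ q
  occ-order p q same occ-p<occ-q =
    ≰⇒> (λ q≤p → <⇒≱ occ-p<occ-q (subst (λ y → C y (toℕ q) ≤ occ S p) same (C-mono (el p) q≤p)))

  Balanced : ℕ → ℕ → Set
  Balanced e c = ∀ x → C x e ≡ c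

  balanced-inside : ∀ {e c} → Balanced e c → ∀ p → toℕ p < e → occ S p < c
  balanced-inside {e} {c} bal p p<e = begin-strict
      occ S p                  <⟨ n<1+n (occ S p) ⟩
      suc (occ S p)            ≡⟨ sym (C-after-self p) ⟩
      C (el p) (suc (toℕ p))   ≤⟨ C-mono (el p) p<e ⟩
      C (el p) e               ≡⟨ bal (el p) ⟩
      c                        ∎
    where open ≤-Reasoning

  balanced-outside : ∀ {e c} → Balanced e c → ∀ p → e ≤ toℕ p → c ≤ occ S p
  balanced-outside {e} bal p e≤p = subst (_≤ occ S p) (bal (el p)) (C-mono (el p) e≤p)

  inside-balanced : ∀ {e c} → Balanced e c → ∀ p → occ S p < c → toℕ p < e
  inside-balanced bal p occ<c = ≰⇒> (λ e≤p → <⇒≱ occ<c (balanced-outside bal p e≤p))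

  outside-balanced : ∀ {e c} → Balanced e c → ∀ p → c ≤ occ S p → e ≤ toℕ p
  outside-balanced bal p c≤occ = ≮⇒≥ (λ p<e → <⇒≱ (balanced-inside bal p p<e) c≤occ)

  balanced-< : Fin n → ∀ {e e' a c} → Balanced e a → Balanced e' c → a < c → e < e'
  balanced-< x bal bal' a<c = ≰⇒> (λ e'≤e → <⇒≱ a<c (subst₂ _≤_ (bal' x) (bal x) (C-mono x e'≤e)))

  segment-readK : ∀ {e e' a c} → e ≤ e' → Balanced e a → Balanced e' c → ReadK (c ∸ a) (segment e e' S)
  segment-readK {e} {e'} {a} {c} e≤e' bal bal' x = begin
      count x seg               ≡⟨ sym (m+n∸m≡n a (count x seg)) ⟩
      a + count x seg ∸ a       ≡⟨ cong (λ m → m + count x seg ∸ a) (sym (bal x)) ⟩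
      C x e + count x seg ∸ a   ≡⟨ cong (_∸ a) (sym (C-segment x e≤e')) ⟩
      C x e' ∸ a                ≡⟨ cong (_∸ a) (bal' x) ⟩
      c ∸ a                     ∎
    where
    open ≡-Reasoning
    seg = segment e e' S

  ReadBetween : ℕ → ℕ → ℕ → Set
  ReadBetween i lo hi = ∀ p → occ S p ≡ i → lo ≤ toℕ p × toℕ p < hi

  -- Between balanced prefixes of levels a and c lie exactly the reads a, …, c−1; the
  -- converse needs one entry of the read to locate it.
  balanced-between : ∀ {e e' a c i} → Balanced e a → Balanced e' c → a ≤ i → i < c → ReadBetween i e e'
  balanced-between {a = a} {c} bal bal' a≤i i<c p occ≡i =
    outside-balanced bal p (subst (a ≤_) (sym occ≡i) a≤i) , inside-balanced bal' p (subst (_< c) (sym occ≡i) i<c)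

  between-balanced : ∀ {e e' a c i} → Balanced e a → Balanced e' c →
                     ∀ p → occ S p ≡ i → ReadBetween i e e' → a ≤ i × i < c
  between-balanced {a = a} {c} bal bal' p occ≡i between =
    subst (a ≤_) occ≡i (balanced-outside bal p (proj₁ (between p occ≡i))) ,
    subst (_< c) occ≡i (balanced-inside bal' p (proj₂ (between p occ≡i)))

  -- Read i lies in block j of a decomposition Rs of the suffix of S starting at position e.
  InBlock : ℕ → List (List (Fin n)) → ℕ → ℕ → Set
  InBlock e Rs i j = ReadBetween i (e + offset Rs j) (e + offset Rs j + length (blk Rs j))

  inBlock-first : ∀ {e} T Rs i → InBlock e (T ∷ Rs) i 0 ≡ ReadBetween i e (e + length T)
  inBlock-first {e} T Rs i = cong (λ lo → ReadBetween i lo (lo + length T)) (+-identityʳ e)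

  inBlock-later : ∀ {e} T Rs i j → InBlock e (T ∷ Rs) i (suc j) ≡ InBlock (e + length T) Rs i j
  inBlock-later {e} T Rs i j =
    cong (λ lo → ReadBetween i lo (lo + length (blk Rs j))) (sym (+-assoc e (length T) (offset Rs j)))

  read-order : ∀ {R : Rel (Fin n) 0ℓ} → Transitive R → ∀ {i} → Linked R (reading S i) →
               ∀ p q → toℕ p < toℕ q → occ S p ≡ i → occ S q ≡ i → R (el p) (el q)
  read-order {R} R-trans {i} sorted p q p<q occ-p occ-q
    with allPairs-trichotomy (AllPairs.zip (values-sorted , positions-sorted))
           (∈-filter⁺ in-read? (∈-allFin p) occ-p) (∈-filter⁺ in-read? (∈-allFin q) occ-q)
    where
    in-read? : ∀ p → Dec (occ S p ≡ i)
    in-read? p = occ S p ℕ.≟ i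
    values-sorted : AllPairs (λ p q → R (el p) (el q)) (filter in-read? (allFin (length S)))
    values-sorted = AllPairsₚ.map⁻ (Linked⇒AllPairs R-trans sorted)
    positions-sorted : AllPairs F._<_ (filter in-read? (allFin (length S)))
    positions-sorted = AllPairsₚ.filter⁺ in-read? (AllPairsₚ.tabulate⁺-< id)
  ... | inj₁ refl               = ⊥-elim (<-irrefl refl p<q)
  ... | inj₂ (inj₁ (R-pq , _))  = R-pq
  ... | inj₂ (inj₂ (_ , q<p))   = ⊥-elim (<-asym p<q q<p)

-- Turns between consecutive reads of a read-k sequence.

module Turns {n : ℕ} (S : List (Fin n)) {k : ℕ} (readK : ReadK k S) where

  open PrefixCounts S

  whole-balanced : Balanced (length S) k
  whole-balanced x = trans (cong (count x) (take-all (length S) S ≤-refl)) (readK x)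

  balanced-≤ : Fin n → ∀ {e c} → e ≤ length S → Balanced e c → c ≤ k
  balanced-≤ x e≤N bal = subst₂ _≤_ (bal x) (whole-balanced x) (C-mono x e≤N)

  copy-of : ∀ x r → r < k → Σ Pos λ p → toℕ p < length S × el p ≡ x × occ S p ≡ r
  copy-of x r r<k = occurrence x r (length S) ≤-refl (subst (r <_) (sym (whole-balanced x)) r<k)

  copy : ∀ x r → r < k → Pos
  copy x r r<k = proj₁ (copy-of x r r<k)

  copy-el : ∀ x r (r<k : r < k) → el (copy x r r<k) ≡ x
  copy-el x r r<k = proj₁ (proj₂ (proj₂ (copy-of x r r<k)))

  copy-occ : ∀ x r (r<k : r < k) → occ S (copy x r r<k) ≡ r
  copy-occ x r r<k = proj₂ (proj₂ (proj₂ (copy-of x r r<k)))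

  record Turn (c : ℕ) (t : Fin n) : Set where
    field
      last-pos   : Pos
      last-elem  : el last-pos ≡ t
      first-pos  : Pos
      first-elem : el first-pos ≡ t
      adjacent   : toℕ first-pos ≡ suc (toℕ last-pos)
      balanced   : Balanced (suc (toℕ last-pos)) c

  turn : ∀ {R : Rel (Fin n) 0ℓ} → Transitive R → ∀ t → (∀ x → ¬ R t x) → ∀ c → suc c < k →
         Linked R (reading S c) → Linked (λ x y → R y x) (reading S (suc c)) → Turn (suc c) t
  turn {R} R-trans t t-maximal c c+1<k read-c read-c+1 = record
      { last-pos = p ; last-elem = el-p ; first-pos = q ; first-elem = el-q
      ; adjacent = adjacent ; balanced = balanced }
    where
    c<k : c < k
    c<k = <-trans (n<1+n c) c+1<k

    p q : Pos
    p = copy t c c<k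
    q = copy t (suc c) c+1<k
    el-p : el p ≡ t
    el-p = copy-el t c c<k
    el-q : el q ≡ t
    el-q = copy-el t (suc c) c+1<k
    occ-p : occ S p ≡ c
    occ-p = copy-occ t c c<k
    occ-q : occ S q ≡ suc c
    occ-q = copy-occ t (suc c) c+1<k

    -- nothing of read c follows p, nothing of read c+1 precedes q: it would exceed t
    read-c-ends : ∀ p' → occ S p' ≡ c → toℕ p' ≤ toℕ p
    read-c-ends p' occ-p' = ≮⇒≥ λ p<p' →
      t-maximal (el p') (subst (λ y → R y (el p')) el-p (read-order R-trans read-c p p' p<p' occ-p occ-p'))
    read-c+1-starts : ∀ q' → occ S q' ≡ suc c → toℕ q ≤ toℕ q'
    read-c+1-starts q' occ-q' = ≮⇒≥ λ q'<q →
      t-maximal (el q') (subst (λ y → R y (el q')) el-q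
        (read-order (λ y<x z<y → R-trans z<y y<x) read-c+1 q' q q'<q occ-q' occ-q))

    p<q : toℕ p < toℕ q
    p<q = occ-order p q (trans el-p (sym el-q)) (subst₂ _<_ (sym occ-p) (sym occ-q) (n<1+n c))

    -- the c-th copy of x is at most p and its (c+1)-th copy beyond p
    balanced : Balanced (suc (toℕ p)) (suc c)
    balanced x = ≤-antisym at-most at-least
      where
      r r' : Pos
      r = copy x c c<k
      r' = copy x (suc c) c+1<k
      occ-r : occ S r ≡ c
      occ-r = copy-occ x c c<k
      occ-r' : occ S r' ≡ suc c
      occ-r' = copy-occ x (suc c) c+1<k
      at-most : C x (suc (toℕ p)) ≤ suc c
      at-most = subst (C x (suc (toℕ p)) ≤_) (trans (cong (λ y → C y (toℕ r')) (sym (copy-el x (suc c) c+1<k))) occ-r')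
                  (C-mono x (<-≤-trans p<q (read-c+1-starts r' occ-r')))
      at-least : suc c ≤ C x (suc (toℕ p))
      at-least = subst (_≤ C x (suc (toℕ p))) (trans (cong (λ y → C y (suc (toℕ r))) (sym (copy-el x c c<k)))
                   (trans (C-after-self r) (cong suc occ-r)))
                   (C-mono x (s≤s (read-c-ends r occ-r)))

    -- position p+1 carries an entry of read c+1, so q is not later than p+1
    adjacent : toℕ q ≡ suc (toℕ p)
    adjacent = ≤-antisym (subst (toℕ q ≤_) (FP.toℕ-fromℕ< p+1<N) (read-c+1-starts next occ-next)) p<q
      where
      p+1<N : suc (toℕ p) < length S
      p+1<N = ≤-<-trans p<q (FP.toℕ<n q)
      next : Pos
      next = fromℕ< p+1<N
      occ-next : occ S next ≡ suc c
      occ-next = trans (cong (C (el next)) (FP.toℕ-fromℕ< p+1<N)) (balanced (el next))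

-- By induction on k: the run found below k either ends
-- before k−1, or reaches k−1 and is then extended to k when f k agrees with f a.
run : (f : ℕ → Bool) → ∀ {a k} → a < k →
      ∃ λ c → a ≤ c × c < k × (∀ r → a ≤ r → r ≤ c → f r ≡ f a) × (suc c < k → f (suc c) ≡ not (f a))
run f {k = zero} ()
run f {a} {suc k} a<k+1 with m<1+n⇒m<n∨m≡n a<k+1
... | inj₂ refl = a , ≤-refl , ≤-refl , (λ r a≤r r≤a → cong f (≤-antisym r≤a a≤r)) , (λ a+1<a+1 → ⊥-elim (<-irrefl refl a+1<a+1))
... | inj₁ a<k with run f a<k
...   | c , a≤c , c<k , same , flips with m≤n⇒m<n∨m≡n c<k
...     | inj₁ c+1<k = c , a≤c , m<n⇒m<1+n c<k , same , (λ _ → flips c+1<k)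
...     | inj₂ refl with f (suc c) Bool.≟ f a
...       | yes same-next = suc c , m≤n⇒m≤1+n a≤c , ≤-refl , same-to-next ,
                            (λ c+2<c+2 → ⊥-elim (<-irrefl refl c+2<c+2))
  where
  same-to-next : ∀ r → a ≤ r → r ≤ suc c → f r ≡ f a
  same-to-next r a≤r r≤c+1 with m≤n⇒m<n∨m≡n r≤c+1
  ... | inj₁ r<c+1 = same r a≤r (≤-pred r<c+1)
  ... | inj₂ refl  = same-next
...       | no differs = c , a≤c , m<n⇒m<1+n c<k , same , (λ _ → ¬-not differs)

-- Direction of block j of an alternating sequence of blocks whose block 0 has direction d.
alternate : ℕ → Bool → Bool
alternate zero    d = d
alternate (suc j) d = alternate j (not d)

alternate-not : ∀ j d → alternate j (not d) ≡ not (alternate j d)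
alternate-not zero    d = refl
alternate-not (suc j) d = alternate-not j (not d)

alternate-even : ∀ j → j % 2 ≡ 0 → alternate j true ≡ true
alternate-even zero          _    = refl
alternate-even (suc zero)    ()
alternate-even (suc (suc j)) even = alternate-even j even

alternate-odd : ∀ j → j % 2 ≡ 1 → alternate j true ≡ false
alternate-odd zero          ()
alternate-odd (suc zero)    _   = refl
alternate-odd (suc (suc j)) odd = alternate-odd j odd

IsAlternating : ∀ {n} → ℕ → List (Fin n) → List (List (Fin n)) → Set
IsAlternating {n} k S Ts =
      concat Ts ≡ S
      × (∀ j → j < length Ts → ∃ λ kj → kj ≤ k × ReadK kj (blk Ts j))
      × (∀ i → i < k → ∃ λ j → j < length Ts × Contained S Ts i j)
      × (∀ j → j < length Ts → ∀ i → i < k → Contained S Ts i j →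
           (j % 2 ≡ 0 → Increasing (reading S i))
           × (j % 2 ≡ 1 → Decreasing (reading S i)))
      × (∀ j → suc j < length Ts → ∃ λ (y : Fin n) →
           last (blk Ts j) ≡ just y
           × head (blk Ts (suc j)) ≡ just y
           × (ContainsInc k S Ts j → ContainsDec k S Ts (suc j) → suc (toℕ y) ≡ n)
           × (ContainsDec k S Ts j → ContainsInc k S Ts (suc j) → toℕ y ≡ 0))

single-block : ∀ {n k} {S : List (Fin n)} → ReadK k S → (∀ i → i < k → Increasing (reading S i)) →
               IsAlternating k S [ S ]
single-block {S = S} readK increasing =
  ++-identityʳ S ,
  (λ { zero _ → _ , ≤-refl , readK ; (suc j) (s≤s ()) }) ,
  (λ i _ → 0 , s≤s z≤n , λ p _ → z≤n , FP.toℕ<n p) ,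
  (λ { zero _ i i<k _ → (λ _ → increasing i i<k) , (λ ()) ; (suc j) (s≤s ()) }) ,
  (λ { j (s≤s ()) })

module Construction {n' k : ℕ} (S : List (Fin (suc n'))) (readK : ReadK k S) (monotone : PerReadMonotone k S) where

  open PrefixCounts S
  open Turns S readK

  X : Set
  X = Fin (suc n')

  N : ℕ
  N = length S

  increasing? : ∀ i → Dec (Increasing (reading S i))
  increasing? i = linked? F._<?_ (reading S i)

  direction : ℕ → Bool
  direction i = does (increasing? i)

  increasing-read : ∀ {i} → direction i ≡ true → Increasing (reading S i)
  increasing-read {i} = from-true (increasing? i)
    where
    from-true : ∀ {A : Set} (a? : Dec A) → does a? ≡ true → A
    from-true (yes a) _  = a
    from-true (no _)  ()

  decreasing-read : ∀ {i} → i < k → direction i ≡ false → Decreasing (reading S i)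
  decreasing-read {i} i<k not-inc with monotone i i<k
  ... | inj₁ inc = contradiction (trans (sym (dec-true (increasing? i) inc)) not-inc) λ ()
  ... | inj₂ dec = dec

  peak : Bool → X
  peak true  = fromℕ n'
  peak false = F.zero

  turn-at : ∀ {d} c → suc c < k → direction c ≡ d → direction (suc c) ≡ not d → Turn (suc c) (peak d)
  turn-at {true} c c+1<k inc dec =
    turn FP.<-trans (fromℕ n') (λ x top<x → <⇒≱ top<x (FP.≤fromℕ x)) c c+1<k
      (increasing-read inc) (decreasing-read c+1<k dec)
  turn-at {false} c c+1<k dec inc =
    turn (λ x>y y>z → FP.<-trans y>z x>y) F.zero (λ x ()) c c+1<k
      (decreasing-read (<-trans (n<1+n c) c+1<k) dec) (increasing-read inc)

  -- Rs decomposes the suffix of S from position e, which holds the reads a, …, k−1, into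
  -- blocks of alternating direction starting with d, meeting at the peaks.
  record Decomposition (e a : ℕ) (d : Bool) (Rs : List (List X)) : Set where
    field
      concatenates : concat Rs ≡ drop e S
      blocks-readK : ∀ j → j < length Rs → ∃ λ kj → kj ≤ k × ReadK kj (blk Rs j)
      covers       : ∀ i → a ≤ i → i < k → ∃ λ j → j < length Rs × InBlock e Rs i j
      directed     : ∀ j → j < length Rs → ∀ i → i < k → InBlock e Rs i j → direction i ≡ alternate j d
      joins        : ∀ j → suc j < length Rs →
                       last (blk Rs j) ≡ just (peak (alternate j d))
                       × head (blk Rs (suc j)) ≡ just (peak (alternate j d))
      starts       : head (blk Rs 0) ≡ head (drop e S)

  finished : ∀ d → Decomposition N k d []
  finished d = record
    { concatenates = sym (drop-all N S ≤-refl)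
    ; blocks-readK = λ _ ()
    ; covers       = λ i k≤i i<k → contradiction k≤i (<⇒≱ i<k)
    ; directed     = λ _ ()
    ; joins        = λ _ ()
    ; starts       = cong head (sym (drop-all N S ≤-refl)) }

  extend : ∀ {e e' a c d Rs} → a < c → e' ≤ N → Balanced e a → Balanced e' c →
           (∀ i → a ≤ i → i < c → direction i ≡ d) →
           (0 < length Rs → last (segment e e' S) ≡ just (peak d) × head (drop e' S) ≡ just (peak d)) →
           Decomposition e' c (not d) Rs → Decomposition e a d (segment e e' S ∷ Rs)
  extend {e} {e'} {a} {c} {d} {Rs} a<c e'≤N bal bal' run-d junction rest = record
    { concatenates = trans (cong (B ++_) R.concatenates) (segment-++ S e≤e')
    ; blocks-readK = blocks-readK
    ; covers       = covers
    ; directed     = directed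
    ; joins        = joins
    ; starts       = segment-head S e<e' }
    where
    module R = Decomposition rest
    B : List X
    B = segment e e' S
    e<e' : e < e'
    e<e' = balanced-< F.zero {e} {e'} bal bal' a<c
    e≤e' : e ≤ e'
    e≤e' = <⇒≤ e<e'
    ends-at : e + length B ≡ e'
    ends-at = segment-length S e≤e' e'≤N
    in-first : ∀ i → InBlock e (B ∷ Rs) i 0 ≡ ReadBetween i e e'
    in-first i = trans (inBlock-first B Rs i) (cong (ReadBetween i e) ends-at)
    in-later : ∀ i j → InBlock e (B ∷ Rs) i (suc j) ≡ InBlock e' Rs i j
    in-later i j = trans (inBlock-later B Rs i j) (cong (λ lo → InBlock lo Rs i j) ends-at)

    blocks-readK : ∀ j → j < suc (length Rs) → ∃ λ kj → kj ≤ k × ReadK kj (blk (B ∷ Rs) j)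
    blocks-readK zero    _   = c ∸ a , ≤-trans (m∸n≤m c a) (balanced-≤ F.zero e'≤N bal') , segment-readK {e} {e'} e≤e' bal bal'
    blocks-readK (suc j) j<  = R.blocks-readK j (≤-pred j<)

    covers : ∀ i → a ≤ i → i < k → ∃ λ j → j < suc (length Rs) × InBlock e (B ∷ Rs) i j
    covers i a≤i i<k with i <? c
    ... | yes i<c = 0 , s≤s z≤n , subst id (sym (in-first i)) (balanced-between bal bal' a≤i i<c)
    ... | no i≮c  = let j , j< , in-j = R.covers i (≮⇒≥ i≮c) i<k
                    in suc j , s≤s j< , subst id (sym (in-later i j)) in-j

    directed : ∀ j → j < suc (length Rs) → ∀ i → i < k → InBlock e (B ∷ Rs) i j → direction i ≡ alternate j d
    directed zero _ i i<k in-B =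
      let a≤i , i<c = between-balanced bal bal' (copy F.zero i i<k) (copy-occ F.zero i i<k) (subst id (in-first i) in-B)
      in run-d i a≤i i<c
    directed (suc j) j< i i<k in-j = R.directed j (≤-pred j<) i i<k (subst id (in-later i j) in-j)

    joins : ∀ j → suc j < suc (length Rs) →
              last (blk (B ∷ Rs) j) ≡ just (peak (alternate j d))
              × head (blk (B ∷ Rs) (suc j)) ≡ just (peak (alternate j d))
    joins zero    1<len = proj₁ (junction (≤-pred 1<len)) , trans R.starts (proj₂ (junction (≤-pred 1<len)))
    joins (suc j) j<    = R.joins j (≤-pred j<)

  -- The suffix after a balanced prefix is decomposed by cutting at the end of its first run and
  -- recursing; the fuel bounds the number of remaining runs.
  decompose : ∀ fuel e a → k ≤ a + fuel → a < k → e ≤ N → Balanced e a → ∃ (Decomposition e a (direction a))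
  decompose zero e a k≤a a<k _ _ = contradiction (subst (k ≤_) (+-identityʳ a) k≤a) (<⇒≱ a<k)
  decompose (suc fuel) e a k≤ a<k e≤N bal with run direction a<k
  ... | c , a≤c , c<k , run-a , flips with m≤n⇒m<n∨m≡n c<k
  ...   | inj₂ refl = [ segment e N S ] ,
                      extend a<k ≤-refl bal whole-balanced (λ i a≤i i<k → run-a i a≤i (≤-pred i<k)) (λ ()) (finished _)
  ...   | inj₁ c+1<k = segment e e' S ∷ proj₁ rest ,
                       extend (s≤s a≤c) e'≤N bal balanced (λ i a≤i i≤c → run-a i a≤i (≤-pred i≤c)) (λ _ → junction) rest'
    where
    open Turn (turn-at c c+1<k (run-a c a≤c ≤-refl) (flips c+1<k))
    e' : ℕ
    e' = suc (toℕ last-pos)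
    e'≤N : e' ≤ N
    e'≤N = FP.toℕ<n last-pos
    e≤p : e ≤ toℕ last-pos
    e≤p = ≤-pred (balanced-< F.zero {e} {e'} bal balanced (s≤s a≤c))
    fewer-runs : k ≤ suc c + fuel
    fewer-runs = ≤-trans k≤ (≤-trans (≤-reflexive (+-suc a fuel)) (+-monoˡ-≤ fuel (s≤s a≤c)))
    rest : ∃ (Decomposition e' (suc c) (direction (suc c)))
    rest = decompose fuel e' (suc c) fewer-runs c+1<k e'≤N balanced
    rest' : Decomposition e' (suc c) (not (direction a)) (proj₁ rest)
    rest' = subst (λ d → Decomposition e' (suc c) d (proj₁ rest)) (flips c+1<k) (proj₂ rest)
    junction : last (segment e e' S) ≡ just (peak (direction a)) × head (drop e' S) ≡ just (peak (direction a))
    junction = trans (segment-last S last-pos e≤p) (cong just last-elem) ,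
               trans (cong (λ m → head (drop m S)) (sym adjacent)) (trans (head-drop S first-pos) (cong just first-elem))

  alternating : ∀ {Ts} → Decomposition 0 0 true Ts → IsAlternating k S Ts
  alternating {Ts} dec = concatenates , blocks-readK , (λ i i<k → covers i z≤n i<k) , monotone-blocks , meets
    where
    open Decomposition dec
    monotone-blocks : ∀ j → j < length Ts → ∀ i → i < k → Contained S Ts i j →
                      (j % 2 ≡ 0 → Increasing (reading S i)) × (j % 2 ≡ 1 → Decreasing (reading S i))
    monotone-blocks j j< i i<k in-j =
      (λ even → increasing-read (trans (directed j j< i i<k in-j) (alternate-even j even))) ,
      (λ odd → decreasing-read i<k (trans (directed j j< i i<k in-j) (alternate-odd j odd)))
    at-top : ∀ {b} → b ≡ true → suc (toℕ (peak b)) ≡ suc n'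
    at-top refl = cong suc (FP.toℕ-fromℕ n')
    at-bottom : ∀ {b} → b ≡ false → toℕ (peak b) ≡ 0
    at-bottom refl = refl
    meets : ∀ j → suc j < length Ts → ∃ λ (y : X) →
              last (blk Ts j) ≡ just y × head (blk Ts (suc j)) ≡ just y
              × (ContainsInc k S Ts j → ContainsDec k S Ts (suc j) → suc (toℕ y) ≡ suc n')
              × (ContainsDec k S Ts j → ContainsInc k S Ts (suc j) → toℕ y ≡ 0)
    meets j j+1< = peak (alternate j true) , proj₁ (joins j j+1<) , proj₂ (joins j j+1<) ,
      (λ { (i , i<k , in-j , inc) _ →
             at-top (trans (sym (directed j (<-trans (n<1+n j) j+1<) i i<k in-j)) (dec-true (increasing? i) inc)) }) ,
      (λ { _ (i , i<k , in-j+1 , inc) →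
             at-bottom (not-injective (trans (sym (alternate-not j true))
                   (trans (sym (directed (suc j) j+1< i i<k in-j+1)) (dec-true (increasing? i) inc)))) })

  decomposition : Increasing (reading S 0) → 0 < k → ∃ (IsAlternating k S)
  decomposition first-increasing 0<k =
    proj₁ whole , alternating (subst (λ d → Decomposition 0 0 d (proj₁ whole)) first-direction (proj₂ whole))
    where
    whole : ∃ (Decomposition 0 0 (direction 0))
    whole = decompose k 0 0 ≤-refl 0<k z≤n (λ x → refl)
    first-direction : direction 0 ≡ true
    first-direction = dec-true (increasing? 0) first-increasing

lemma5p7 : ∀ (n k : ℕ) (S : List (Fin n)) →
    ReadK k S → PerReadMonotone k S → Increasing (reading S 0) →
    ∃ λ (Ts : List (List (Fin n))) →
      concat Ts ≡ S
      × (∀ j → j < length Ts → ∃ λ kj → kj ≤ k × ReadK kj (blk Ts j))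
      × (∀ i → i < k → ∃ λ j → j < length Ts × Contained S Ts i j)
      × (∀ j → j < length Ts → ∀ i → i < k → Contained S Ts i j →
           (j % 2 ≡ 0 → Increasing (reading S i))
           × (j % 2 ≡ 1 → Decreasing (reading S i)))
      × (∀ j → suc j < length Ts → ∃ λ (y : Fin n) →
           last (blk Ts j) ≡ just y
           × head (blk Ts (suc j)) ≡ just y
           × (ContainsInc k S Ts j → ContainsDec k S Ts (suc j) → suc (toℕ y) ≡ n)
           × (ContainsDec k S Ts j → ContainsInc k S Ts (suc j) → toℕ y ≡ 0))
-- Over the empty alphabet S is empty, and without reads every condition on reads is
-- vacuous: a single block suffices.  Otherwise cut at the changes of direction.
lemma5p7 zero     k       []        readK _        _           = [ [] ] , single-block readK (λ _ _ → [])
lemma5p7 zero     k       (() ∷ _)  _     _        _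
lemma5p7 (suc n') zero    S         readK _        _           = [ S ] , single-block readK (λ _ ())
lemma5p7 (suc n') (suc k) S         readK monotone first-inc   =
  Construction.decomposition S readK monotone first-inc (s≤s z≤n)
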